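{- (1) For every digraph $D$, ${\rm adi}(D)\le \tau(D)+1$. (2) For every graph $G$, ${\rm ava}(G)\le\tau(G)+1$.
   Context: Graphs are finite, loopless and may have multiple edges (a bigon counts as a cycle of length 2); digraphs are finite, loopless and may have parallel and anti-parallel arcs (a digon counts as a directed cycle of length 2). A \emph{complete acyclic coloring} of a digraph $D$ is a partition of $V(D)$ into color classes each inducing an acyclic subdigraph such that the union of any two distinct color classes induces a subdigraph containing a directed cycle; ${\rm adi}(D)$ is the maximum number of colors in such a coloring. A \emph{complete arboreal coloring} of a graph $G$ is a partition of $V(G)$ into color classes each inducing a forest such that the union of any two distinct color classes induces a subgraph containing a cycle; ${\rm ava}(G)$ is the maximum number of colors in such a coloring. $\tau(D)$ (resp. $\tau(G)$) is the minimum size of a vertex set whose deletion leaves an acyclic digraph (resp. a forest). -}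

module Defs where

open import Data.Nat using (ℕ; suc)
open import Data.Fin using (Fin; zero; suc; inject₁; fromℕ)
open import Data.Fin.Subset using (Subset; _∉_)
open import Data.Product using (_×_; _,_; proj₁; proj₂; Σ)
open import Data.Sum using (_⊎_)
open import Function.Definitions using (Injective; Surjective)
open import Relation.Binary.PropositionalEquality using (_≡_)
open import Relation.Nullary using (¬_)

-- A (multi)digraph on vertex set Fin n with m arcs; arc e goes from
-- proj₁ (arc e) to proj₂ (arc e).  Parallel / anti-parallel arcs allowed.
record Digraph : Set where
  field
    n m      : ℕ
    arc      : Fin m → Fin n × Fin n
    loopless : ∀ e → ¬ (proj₁ (arc e) ≡ proj₂ (arc e))

-- A (multi)graph on vertex set Fin n with m edges; edge e joins the two
-- components of (edge e).  Multiple edges allowed.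
record Graph : Set where
  field
    n m      : ℕ
    edge     : Fin m → Fin n × Fin n
    loopless : ∀ e → ¬ (proj₁ (edge e) ≡ proj₂ (edge e))

Joins : ∀ {n} → Fin n × Fin n → Fin n → Fin n → Set
Joins p u v = (proj₁ p ≡ u × proj₂ p ≡ v) ⊎ (proj₁ p ≡ v × proj₂ p ≡ u)

record DiCycleIn (D : Digraph) (P : Fin (Digraph.n D) → Set) : Set where
  open Digraph D
  field
    k     : ℕ
    k≥1   : 1 Data.Nat.≤ k
    vs    : Fin (suc k) → Fin n
    es    : Fin (suc k) → Fin m
    vs-inj : Injective _≡_ _≡_ vs
    es-inj : Injective _≡_ _≡_ es
    inP   : ∀ i → P (vs i)
    step  : ∀ (i : Fin k) → arc (es (inject₁ i)) ≡ (vs (inject₁ i) , vs (suc i))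
    close : arc (es (fromℕ k)) ≡ (vs (fromℕ k) , vs zero)

-- A cycle of length (suc k), k ≥ 1 (k = 1: a bigon, two distinct parallel edges)
-- in the subgraph induced by the vertices satisfying P.
record CycleIn (G : Graph) (P : Fin (Graph.n G) → Set) : Set where
  open Graph G
  field
    k     : ℕ
    k≥1   : 1 Data.Nat.≤ k
    vs    : Fin (suc k) → Fin n
    es    : Fin (suc k) → Fin m
    vs-inj : Injective _≡_ _≡_ vs
    es-inj : Injective _≡_ _≡_ es
    inP   : ∀ i → P (vs i)
    step  : ∀ (i : Fin k) → Joins (edge (es (inject₁ i))) (vs (inject₁ i)) (vs (suc i))
    close : Joins (edge (es (fromℕ k))) (vs (fromℕ k)) (vs zero)

-- Complete acyclic coloring of D with exactly c colors: a surjective map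
-- col : V(D) → Fin c (so the classes partition V(D) into c nonempty parts),
-- each class induces an acyclic subdigraph, and the union of any two distinct
-- classes induces a subdigraph containing a directed cycle.
record CompleteAcyclicColoring (D : Digraph) (c : ℕ) : Set where
  field
    col      : Fin (Digraph.n D) → Fin c
    onto     : Surjective _≡_ _≡_ col
    acyclic  : ∀ i → ¬ DiCycleIn D (λ v → col v ≡ i)
    complete : ∀ i j → ¬ (i ≡ j) → DiCycleIn D (λ v → col v ≡ i ⊎ col v ≡ j)

record CompleteArborealColoring (G : Graph) (c : ℕ) : Set where
  field
    col      : Fin (Graph.n G) → Fin c
    onto     : Surjective _≡_ _≡_ col
    forest   : ∀ i → ¬ CycleIn G (λ v → col v ≡ i)
    complete : ∀ i j → ¬ (i ≡ j) → CycleIn G (λ v → col v ≡ i ⊎ col v ≡ j)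

IsDiFVS : (D : Digraph) → Subset (Digraph.n D) → Set
IsDiFVS D X = ¬ DiCycleIn D (λ v → v ∉ X)

IsFVS : (G : Graph) → Subset (Graph.n G) → Set
IsFVS G X = ¬ CycleIn G (λ v → v ∉ X)

module Submission where

-- Let col be a complete colouring (acyclic resp. arboreal) with c colours and
-- X a feedback vertex set.  For two distinct colours i, j the union of their
-- classes carries a cycle; since D − X (resp. G − X) has none, that union
-- meets X.  So at most one colour class is disjoint from X, while the classes
-- meeting X are indexed by the image col[X], of size at most ∣X∣.  Hence
-- c = ∣col[X]∣ + ∣∁ col[X]∣ ≤ ∣X∣ + 1.

open import Defs
open import Data.Nat using (ℕ; _≤_; _+_; suc; z≤n; s≤s)
open import Data.Nat.Properties
  using (≤-trans; ≤-reflexive; +-mono-≤; +-suc; n≤1+n; +-monoʳ-≤; m+[n∸m]≡n)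
open import Data.Product using (_×_; _,_)
open import Data.Sum using (_⊎_; inj₁; inj₂)
open import Data.Vec using (_∷_; []; here; there)
open import Data.Fin using (Fin) renaming (zero to fzero; suc to fsuc)
open import Data.Fin.Properties using (_≟_)
open import Data.Fin.Subset using (Subset; ∣_∣; _∪_; ⁅_⁆; ⊥; ∁; _∈_; _∉_; _⊆_; inside; outside)
open import Data.Fin.Subset.Properties
  using (nonempty?; Empty-unique; ∣⊥∣≡0; ∣⁅x⁆∣≡1; x∈⁅x⁆; p⊆q⇒∣p∣≤∣q∣; x∈p∪q⁺; x∈∁p⇒x∉p; ∣∁p∣≡n∸∣p∣; ∣p∣≤n)
open import Relation.Binary.PropositionalEquality using (_≡_; refl; sym; trans; cong; subst)
open import Relation.Nullary using (¬_; yes; no)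
open import Data.Empty using (⊥-elim)

∣p∪q∣≤∣p∣+∣q∣ : ∀ {n} (p q : Subset n) → ∣ p ∪ q ∣ ≤ ∣ p ∣ + ∣ q ∣
∣p∪q∣≤∣p∣+∣q∣ []            []            = z≤n
∣p∪q∣≤∣p∣+∣q∣ (outside ∷ p) (outside ∷ q) = ∣p∪q∣≤∣p∣+∣q∣ p q
∣p∪q∣≤∣p∣+∣q∣ (outside ∷ p) (inside ∷ q)  =
  ≤-trans (s≤s (∣p∪q∣≤∣p∣+∣q∣ p q)) (≤-reflexive (sym (+-suc ∣ p ∣ ∣ q ∣)))
∣p∪q∣≤∣p∣+∣q∣ (inside ∷ p)  (outside ∷ q) = s≤s (∣p∪q∣≤∣p∣+∣q∣ p q)
∣p∪q∣≤∣p∣+∣q∣ (inside ∷ p)  (inside ∷ q)  =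
  s≤s (≤-trans (∣p∪q∣≤∣p∣+∣q∣ p q) (+-monoʳ-≤ ∣ p ∣ (n≤1+n ∣ q ∣)))

∣p∣+∣∁p∣≡n : ∀ {n} (p : Subset n) → ∣ p ∣ + ∣ ∁ p ∣ ≡ n
∣p∣+∣∁p∣≡n p = trans (cong (∣ p ∣ +_) (∣∁p∣≡n∸∣p∣ p)) (m+[n∸m]≡n (∣p∣≤n p))

subsingleton-∣p∣≤1 : ∀ {n} (p : Subset n) →
                     (∀ {x y} → x ∈ p → y ∈ p → x ≡ y) → ∣ p ∣ ≤ 1
subsingleton-∣p∣≤1 {n} p unique with nonempty? p
... | yes (x , x∈p) = subst (∣ p ∣ ≤_) (∣⁅x⁆∣≡1 x) (p⊆q⇒∣p∣≤∣q∣ p⊆⁅x⁆)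
  where
  p⊆⁅x⁆ : p ⊆ ⁅ x ⁆
  p⊆⁅x⁆ y∈p = subst (_∈ ⁅ x ⁆) (unique x∈p y∈p) (x∈⁅x⁆ x)
... | no p-empty = subst (_≤ 1) (sym (trans (cong ∣_∣ (Empty-unique p-empty)) (∣⊥∣≡0 n))) z≤n

image : ∀ {n c} → (Fin n → Fin c) → Subset n → Subset c
image f []            = ⊥
image f (outside ∷ X) = image (λ v → f (fsuc v)) X
image f (inside ∷ X)  = ⁅ f fzero ⁆ ∪ image (λ v → f (fsuc v)) X

∣image∣≤∣X∣ : ∀ {n c} (f : Fin n → Fin c) (X : Subset n) → ∣ image f X ∣ ≤ ∣ X ∣
∣image∣≤∣X∣ {c = c} f []      = ≤-reflexive (∣⊥∣≡0 c)
∣image∣≤∣X∣ f (outside ∷ X)   = ∣image∣≤∣X∣ (λ v → f (fsuc v)) X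
∣image∣≤∣X∣ f (inside ∷ X)    =
  ≤-trans (∣p∪q∣≤∣p∣+∣q∣ ⁅ f fzero ⁆ _)
          (subst (λ k → k + ∣ image f′ X ∣ ≤ suc ∣ X ∣) (sym (∣⁅x⁆∣≡1 (f fzero)))
                 (s≤s (∣image∣≤∣X∣ f′ X)))
  where f′ = λ v → f (fsuc v)

∈-image : ∀ {n c} (f : Fin n → Fin c) (X : Subset n) {v} → v ∈ X → f v ∈ image f X
∈-image f (inside ∷ X)  {fzero}  here         = x∈p∪q⁺ (inj₁ (x∈⁅x⁆ (f fzero)))
∈-image f (outside ∷ X) {fsuc v} (there v∈X)  = ∈-image (λ w → f (fsuc w)) X v∈X
∈-image f (inside ∷ X)  {fsuc v} (there v∈X)  = x∈p∪q⁺ (inj₂ (∈-image (λ w → f (fsuc w)) X v∈X))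

ClassesAvoid : ∀ {n c} → (Fin n → Fin c) → Subset n → Fin c → Fin c → Set
ClassesAvoid col X i j = ∀ v → col v ≡ i ⊎ col v ≡ j → v ∉ X

-- Colour counting: if no two distinct colour classes jointly avoid X, then
-- there are at most ∣X∣ + 1 colours (at most ∣X∣ classes meet X and at most
-- one class misses it).
colours-bound : ∀ {n c} (col : Fin n → Fin c) (X : Subset n) →
                (∀ i j → ¬ i ≡ j → ¬ ClassesAvoid col X i j) → c ≤ ∣ X ∣ + 1
colours-bound {c = c} col X no-avoiding-pair = begin
    c                 ≡⟨ sym (∣p∣+∣∁p∣≡n S) ⟩
    ∣ S ∣ + ∣ ∁ S ∣   ≤⟨ +-mono-≤ (∣image∣≤∣X∣ col X) (subsingleton-∣p∣≤1 (∁ S) missing-unique) ⟩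
    ∣ X ∣ + 1         ∎
  where
  open Data.Nat.Properties.≤-Reasoning
  S = image col X

  class-misses-X : ∀ {i} → i ∈ ∁ S → ∀ v → col v ≡ i → v ∉ X
  class-misses-X i∉S v refl v∈X = x∈∁p⇒x∉p i∉S (∈-image col X v∈X)

  missing-unique : ∀ {i j} → i ∈ ∁ S → j ∈ ∁ S → i ≡ j
  missing-unique {i} {j} i∉S j∉S with i ≟ j
  ... | yes i≡j = i≡j
  ... | no  i≢j = ⊥-elim (no-avoiding-pair i j i≢j avoid)
    where
    avoid : ClassesAvoid col X i j
    avoid v (inj₁ coli) = class-misses-X i∉S v coli
    avoid v (inj₂ colj) = class-misses-X j∉S v colj

DiCycleIn-weaken : ∀ {D P Q} → (∀ {v} → P v → Q v) → DiCycleIn D P → DiCycleIn D Q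
DiCycleIn-weaken P⇒Q C = record
  { k = k ; k≥1 = k≥1 ; vs = vs ; es = es ; vs-inj = vs-inj ; es-inj = es-inj
  ; inP = λ i → P⇒Q (inP i) ; step = step ; close = close }
  where open DiCycleIn C

CycleIn-weaken : ∀ {G P Q} → (∀ {v} → P v → Q v) → CycleIn G P → CycleIn G Q
CycleIn-weaken P⇒Q C = record
  { k = k ; k≥1 = k≥1 ; vs = vs ; es = es ; vs-inj = vs-inj ; es-inj = es-inj
  ; inP = λ i → P⇒Q (inP i) ; step = step ; close = close }
  where open CycleIn C

proposition2p2 :
    (∀ (D : Digraph) (c : ℕ) (X : Subset (Digraph.n D)) →
       CompleteAcyclicColoring D c → IsDiFVS D X → c ≤ ∣ X ∣ + 1)
    ×
    (∀ (G : Graph) (c : ℕ) (X : Subset (Graph.n G)) →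
       CompleteArborealColoring G c → IsFVS G X → c ≤ ∣ X ∣ + 1)
proposition2p2 = digraph-bound , graph-bound
  where
  -- two classes avoiding X would give a cycle in D − X (resp. G − X)
  digraph-bound : ∀ D c X → CompleteAcyclicColoring D c → IsDiFVS D X → c ≤ ∣ X ∣ + 1
  digraph-bound D c X K acyclic-D−X = colours-bound col X λ i j i≢j avoid →
      acyclic-D−X (DiCycleIn-weaken (λ {v} → avoid v) (complete i j i≢j))
    where open CompleteAcyclicColoring K

  graph-bound : ∀ G c X → CompleteArborealColoring G c → IsFVS G X → c ≤ ∣ X ∣ + 1
  graph-bound G c X K forest-G−X = colours-bound col X λ i j i≢j avoid →
      forest-G−X (CycleIn-weaken (λ {v} → avoid v) (complete i j i≢j))
    where open CompleteArborealColoring K
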